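{- Let $G$ be a finite abelian group. For a subgroup $K$ of $G$ let $\mathbf{1}_{K}\in L^{2}(G)$ be its indicator function. Then the set \[ \{\mathbf{1}_{K}\;:\;K\text{ a subgroup of }G\text{ such that }K^{\perp}\text{ is a cyclic subgroup of }\widehat{G}\} \] is linearly independent in $L^{2}(G)$.
   Context: $L^2(G)$ is the complex vector space of functions $G\to\mathbf{C}$. $\widehat{G}$ is the group of homomorphisms $G\to\mathbf{C}^{\times}$ under pointwise multiplication. For a subgroup $K\le G$, $K^{\perp}=\{\chi\in\widehat{G}:\chi(k)=1\text{ for all }k\in K\}$. -}

module Defs where

open import Level using (Level; _⊔_)
open import Data.Nat using (ℕ; zero; suc)
open import Data.Fin using (Fin) renaming (zero to fzero; suc to fsuc)
open import Data.Bool using (Bool; true; false; if_then_else_)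
open import Data.List using (List; []; _∷_; _++_)
open import Data.Product using (Σ; ∃; _×_; _,_)
open import Relation.Nullary using (¬_)
open import Relation.Binary.PropositionalEquality using (_≡_)
open import Algebra.Bundles using (AbelianGroup; CommutativeRing)

-- The scalar field: an algebraically closed field of characteristic 0
-- (stands in for ℂ, which does not exist in agda-stdlib).

module _ {c ℓ : Level} (R : CommutativeRing c ℓ) where
  open CommutativeRing R renaming (Carrier to C)

  natMul : ℕ → C
  natMul zero    = 0#
  natMul (suc n) = 1# + natMul n

  horner : List C → C → C
  horner []       x = 0#
  horner (a ∷ as) x = a + x * horner as x

  record IsAlgClosedChar0Field : Set (c ⊔ ℓ) where
    field
      1≉0      : ¬ (1# ≈ 0#)
      inverse  : ∀ x → ¬ (x ≈ 0#) → ∃ λ y → x * y ≈ 1#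
      char0    : ∀ n → ¬ (natMul (suc n) ≈ 0#)
      -- every monic polynomial a₀ + a₁ x + … + xᵈ of degree d ≥ 1 has a root
      algClosed : ∀ (a : C) (as : List C) → ∃ λ x → horner (a ∷ as ++ 1# ∷ []) x ≈ 0#

module _ {a ℓ : Level} (G : AbelianGroup a ℓ) where
  open AbelianGroup G

  record IsFinite : Set (a ⊔ ℓ) where
    field
      size    : ℕ
      toFin   : Carrier → Fin size
      fromFin : Fin size → Carrier
      toFin-cong     : ∀ {x y} → x ≈ y → toFin x ≡ toFin y
      fromFin-toFin  : ∀ x → fromFin (toFin x) ≈ x
      toFin-fromFin  : ∀ i → toFin (fromFin i) ≡ i

  record Subgroup : Set (a ⊔ ℓ) where
    field
      mem      : Carrier → Bool
      mem-cong : ∀ {x y} → x ≈ y → mem x ≡ mem y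
      mem-ε    : mem ε ≡ true
      mem-∙    : ∀ {x y} → mem x ≡ true → mem y ≡ true → mem (x ∙ y) ≡ true
      mem-⁻¹   : ∀ {x} → mem x ≡ true → mem (x ⁻¹) ≡ true

module _ {a ℓ c ℓ' : Level} (G : AbelianGroup a ℓ) (R : CommutativeRing c ℓ') where
  open AbelianGroup G renaming (Carrier to A; _≈_ to _≈G_)
  open CommutativeRing R renaming (Carrier to C; _≈_ to _≈R_)

  -- Elements of Ĝ: homomorphisms G → C^× (C^× = nonzero elements under *).
  record Character : Set (a ⊔ ℓ ⊔ c ⊔ ℓ') where
    field
      χ       : A → C
      χ-cong  : ∀ {x y} → x ≈G y → χ x ≈R χ y
      χ-unit  : ∀ x → ¬ (χ x ≈R 0#)
      χ-hom   : ∀ x y → χ (x ∙ y) ≈R (χ x * χ y)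

  open Character public

  pow : C → ℕ → C
  pow x zero    = 1#
  pow x (suc n) = x * pow x n

  _≈Ĝ_ : Character → Character → Set (a ⊔ ℓ')
  ψ ≈Ĝ φ = ∀ x → χ ψ x ≈R χ φ x

  _∈⊥_ : Character → Subgroup G → Set (a ⊔ ℓ')
  φ ∈⊥ K = ∀ k → Subgroup.mem K k ≡ true → χ φ k ≈R 1#

  -- K^⊥ is a cyclic subgroup of Ĝ: it is generated by a single element ψ,
  -- i.e. K^⊥ = {ψⁿ : n ∈ ℕ} (ψⁿ taken pointwise; Ĝ is finite so ℕ-powers
  -- give the whole generated subgroup).
  PerpCyclic : Subgroup G → Set (a ⊔ ℓ ⊔ c ⊔ ℓ')
  PerpCyclic K = Σ Character λ ψ → (ψ ∈⊥ K) ×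
    (∀ φ → φ ∈⊥ K → ∃ λ n → ∀ x → χ φ x ≈R pow (χ ψ x) n)

  -- indicator function 1_K ∈ L²(G) = (G → C)
  indicator : Subgroup G → A → C
  indicator K x = if Subgroup.mem K x then 1# else 0#

  sumFin : (m : ℕ) → (Fin m → C) → C
  sumFin zero    f = 0#
  sumFin (suc m) f = f fzero + sumFin m (λ i → f (fsuc i))

-- Let Σᵢ cᵢ 1_{Kᵢ} = 0 with the Kᵢ pairwise distinct; we show cᵢ = 0 by strong
-- induction on |Kᵢ|.  Let ψ generate Kᵢ^⊥ and pair the relation with ψ, using
-- ⟨1_K, ψ⟩ = Σₓ 1_K(x) ψ(x) = |K| if ψ ∈ K^⊥ and 0 otherwise.  Characters
-- separate points from subgroups, and every element of Kᵢ^⊥ is a power of ψ,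
-- so ψ(x) = 1 only for x ∈ Kᵢ.  Hence the pairing kills 1_{Kⱼ} for Kⱼ ⊄ Kᵢ,
-- the Kⱼ ⊊ Kᵢ have cⱼ = 0 by induction, and what remains is cᵢ |Kᵢ| = 0.
module Submission where

open import Defs
open import Level using (_⊔_)
open import Data.Nat as ℕ using (ℕ; zero; suc)
open import Data.Fin using (Fin; toℕ) renaming (zero to fzero; suc to fsuc)
open import Data.Bool as Bool using (Bool; true; false; if_then_else_)
import Data.Bool.Properties as BoolP
open import Data.Product using (Σ; ∃; _×_; _,_; proj₁; proj₂)
open import Data.List using ([]; _∷_; _++_; replicate)
open import Data.Sum using (_⊎_; inj₁; inj₂)
open import Data.Empty using (⊥; ⊥-elim)
open import Function using (_∘_)
open import Relation.Nullary using (¬_; yes; no)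
open import Relation.Nullary.Decidable using (_×-dec_)
open import Relation.Binary.PropositionalEquality as ≡ using (_≡_)
open import Algebra.Bundles using (AbelianGroup; CommutativeRing)
import Data.Nat.Properties as ℕP
import Data.Fin.Properties as FinP
import Data.Fin.Permutation as Perm
import Data.Nat.Induction as ℕI
open import Induction.WellFounded using (module All)
import Relation.Binary.Construct.On as On
import Relation.Binary.Reasoning.Setoid as SetoidReasoning

true-and-false : ∀ {b : Bool} → b ≡ true → b ≡ false → ⊥
true-and-false ≡.refl ()

module Powers {c ℓ} (R : CommutativeRing c ℓ) where
  open CommutativeRing R
  open import Algebra.Properties.Semiring.Exp semiring public using (_^_; ^-congˡ; ^-homo-*)

  pow≡^ : ∀ {a ℓ₁} (G : AbelianGroup a ℓ₁) x n → pow G R x n ≡ x ^ n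
  pow≡^ G x zero    = ≡.refl
  pow≡^ G x (suc n) = ≡.cong (x *_) (pow≡^ G x n)

  1^n≈1 : ∀ n → 1# ^ n ≈ 1#
  1^n≈1 zero    = refl
  1^n≈1 (suc n) = trans (*-identityˡ _) (1^n≈1 n)

module FieldFacts {c ℓ} (R : CommutativeRing c ℓ) (F : IsAlgClosedChar0Field R) where
  open CommutativeRing R renaming (Carrier to C)
  open IsAlgClosedChar0Field F
  open Powers R
  open import Algebra.Properties.Ring ring using (x[y-z]≈xy-xz; [y-z]x≈yx-zx)
  open import Algebra.Properties.Group +-group using (x∙y⁻¹≈ε⇒x≈y; x≈y⇒x∙y⁻¹≈ε)
  open import Algebra.Solver.Ring.NaturalCoefficients.Default commutativeSemiring
  open SetoidReasoning setoid

  cancel-nonzero : ∀ {x y} → ¬ (x ≈ 0#) → x * y ≈ 0# → y ≈ 0#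
  cancel-nonzero {x} {y} x≉0 xy≈0 with inverse x x≉0
  ... | u , xu≈1 = begin
    y           ≈⟨ sym (*-identityˡ y) ⟩
    1# * y      ≈⟨ *-congʳ (sym xu≈1) ⟩
    (x * u) * y ≈⟨ solve 3 (λ x u y → (x :* u) :* y := u :* (x :* y)) refl x u y ⟩
    u * (x * y) ≈⟨ *-congˡ xy≈0 ⟩
    u * 0#      ≈⟨ zeroʳ u ⟩
    0#          ∎

  *-nonzero : ∀ {x y} → ¬ (x ≈ 0#) → ¬ (y ≈ 0#) → ¬ (x * y ≈ 0#)
  *-nonzero x≉0 y≉0 xy≈0 = y≉0 (cancel-nonzero x≉0 xy≈0)

  *-cancelˡ : ∀ {x y z} → ¬ (x ≈ 0#) → x * y ≈ x * z → y ≈ z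
  *-cancelˡ {x} {y} {z} x≉0 e = x∙y⁻¹≈ε⇒x≈y y z
    (cancel-nonzero x≉0 (trans (x[y-z]≈xy-xz x y z) (x≈y⇒x∙y⁻¹≈ε e)))

  fixed⇒zero : ∀ {a t} → ¬ (a ≈ 1#) → a * t ≈ t → t ≈ 0#
  fixed⇒zero {a} {t} a≉1 at≈t = cancel-nonzero (λ d → a≉1 (x∙y⁻¹≈ε⇒x≈y a 1# d))
    (trans ([y-z]x≈yx-zx t a 1#) (x≈y⇒x∙y⁻¹≈ε (trans at≈t (sym (*-identityˡ t)))))

  ^-nonzero : ∀ {x} n → ¬ (x ≈ 0#) → ¬ (x ^ n ≈ 0#)
  ^-nonzero zero    x≉0 = 1≉0
  ^-nonzero (suc n) x≉0 = *-nonzero x≉0 (^-nonzero n x≉0)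

  natMul-nonzero : ∀ n → 1 ℕ.≤ n → ¬ (natMul R n ≈ 0#)
  natMul-nonzero (suc n) _ = char0 n

  horner-monomial : ∀ k x → horner R (replicate k 0# ++ 1# ∷ []) x ≈ x ^ k
  horner-monomial zero    x = trans (+-congˡ (zeroʳ x)) (+-identityʳ 1#)
  horner-monomial (suc k) x = trans (+-identityˡ _) (*-congˡ (horner-monomial k x))

  -- d-th roots exist (root of xᵈ - b)
  root : (b : C) (k : ℕ) → ∃ λ x → x ^ suc k ≈ b
  root b k with algClosed (- b) (replicate k 0#)
  ... | x , h = x , x∙y⁻¹≈ε⇒x≈y _ b
    (trans (+-comm _ (- b)) (trans (+-congˡ (sym (*-congˡ (horner-monomial k x)))) h))

  geometric : ℕ → C → C
  geometric n = horner R (replicate n 1#)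

  geometric-shift : ∀ n x → x * geometric n x + 1# ≈ geometric n x + x ^ n
  geometric-shift zero    x = +-congʳ (zeroʳ x)
  geometric-shift (suc n) x = begin
    x * (1# + x * g) + 1#  ≈⟨ solve 2 (λ x g → x :* (con 1 :+ x :* g) :+ con 1
                                          := con 1 :+ x :* (x :* g :+ con 1)) refl x g ⟩
    1# + x * (x * g + 1#)  ≈⟨ +-congˡ (*-congˡ (geometric-shift n x)) ⟩
    1# + x * (g + x ^ n)   ≈⟨ solve 3 (λ x g p → con 1 :+ x :* (g :+ p)
                                          := (con 1 :+ x :* g) :+ x :* p) refl x g (x ^ n) ⟩
    (1# + x * g) + x * x ^ n ∎
    where g = geometric n x

  geometric-at-1 : ∀ n → geometric n 1# ≈ natMul R n
  geometric-at-1 zero    = refl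
  geometric-at-1 (suc n) = +-congˡ (trans (*-identityˡ _) (geometric-at-1 n))

  -- A root ζ of g_{k+2}: then ζ^{k+2} = 1, and ζ ≠ 1 because g_{k+2}(1) = k+2 ≠ 0.
  nontrivial-root-of-unity : (k : ℕ) → ∃ λ ζ → (ζ ^ suc (suc k) ≈ 1#) × ¬ (ζ ≈ 1#)
  nontrivial-root-of-unity k with algClosed 1# (replicate k 1#)
  ... | ζ , h = ζ , ζ^d≈1 , ζ≉1
    where
    d = suc (suc k)
    replicate-snoc : ∀ k → replicate k 1# ++ 1# ∷ [] ≡ replicate (suc k) 1#
    replicate-snoc zero    = ≡.refl
    replicate-snoc (suc k) = ≡.cong (1# ∷_) (replicate-snoc k)
    gζ≈0 : geometric d ζ ≈ 0#
    gζ≈0 = ≡.subst (λ l → horner R (1# ∷ l) ζ ≈ 0#) (replicate-snoc k) h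
    ζ^d≈1 : ζ ^ d ≈ 1#
    ζ^d≈1 = sym (begin
      1#                      ≈⟨ sym (+-identityˡ 1#) ⟩
      0# + 1#                 ≈⟨ +-congʳ (sym (trans (*-congˡ gζ≈0) (zeroʳ ζ))) ⟩
      ζ * geometric d ζ + 1#  ≈⟨ geometric-shift d ζ ⟩
      geometric d ζ + ζ ^ d   ≈⟨ +-congʳ gζ≈0 ⟩
      0# + ζ ^ d              ≈⟨ +-identityˡ _ ⟩
      ζ ^ d                   ∎)
    ζ≉1 : ¬ (ζ ≈ 1#)
    ζ≉1 ζ≈1 = char0 (suc k) (trans (sym (geometric-at-1 d))
      (trans (horner-cong (replicate d 1#) (sym ζ≈1)) gζ≈0))
      where
      horner-cong : ∀ l {x y} → x ≈ y → horner R l x ≈ horner R l y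
      horner-cong []      e = refl
      horner-cong (a ∷ l) e = +-congˡ (*-cong e (horner-cong l e))

module Counting where
  bit : Bool → ℕ
  bit true  = 1
  bit false = 0

  count : (n : ℕ) → (Fin n → Bool) → ℕ
  count zero    b = 0
  count (suc n) b = bit (b fzero) ℕ.+ count n (b ∘ fsuc)

  count-pos : ∀ n (b : Fin n → Bool) t → b t ≡ true → 1 ℕ.≤ count n b
  count-pos (suc n) b fzero    bt rewrite bt = ℕ.s≤s ℕ.z≤n
  count-pos (suc n) b (fsuc t) bt = ℕP.≤-trans (count-pos n (b ∘ fsuc) t bt) (ℕP.m≤n+m _ _)

  _⊆ᵇ_ : ∀ {n} → (Fin n → Bool) → (Fin n → Bool) → Set
  b ⊆ᵇ b′ = ∀ t → b t ≡ true → b′ t ≡ true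

  bit-mono : ∀ {x y} → (x ≡ true → y ≡ true) → bit x ℕ.≤ bit y
  bit-mono {false} _   = ℕ.z≤n
  bit-mono {true}  x⇒y rewrite x⇒y ≡.refl = ℕP.≤-refl

  count-mono : ∀ n {b b′ : Fin n → Bool} → b ⊆ᵇ b′ → count n b ℕ.≤ count n b′
  count-mono zero    _    = ℕ.z≤n
  count-mono (suc n) b⊆b′ = ℕP.+-mono-≤ (bit-mono (b⊆b′ fzero)) (count-mono n (b⊆b′ ∘ fsuc))

  count-strict : ∀ n {b b′ : Fin n → Bool} → b ⊆ᵇ b′ →
    ∀ t → b t ≡ false → b′ t ≡ true → count n b ℕ.< count n b′
  count-strict (suc n) {b} {b′} b⊆b′ fzero bt b′t rewrite bt | b′t =
    ℕ.s≤s (count-mono n (b⊆b′ ∘ fsuc))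
  count-strict (suc n) b⊆b′ (fsuc t) bt b′t =
    ℕP.+-mono-≤-< (bit-mono (b⊆b′ fzero)) (count-strict n (b⊆b′ ∘ fsuc) t bt b′t)

  ⊆ᵇ-or-witness : ∀ {n} (b b′ : Fin n → Bool) → b ⊆ᵇ b′ ⊎ ∃ λ t → b t ≡ true × b′ t ≡ false
  ⊆ᵇ-or-witness b b′ with FinP.any? (λ t → (b t Bool.≟ true) ×-dec (b′ t Bool.≟ false))
  ... | yes witness = inj₂ witness
  ... | no  none    = inj₁ (λ t bt → BoolP.¬-not (λ b′t → none (t , bt , b′t)))

  ⊊ᵇ-witness : ∀ {n} (b b′ : Fin n → Bool) → b ⊆ᵇ b′ → ¬ (∀ t → b t ≡ b′ t) →
    ∃ λ t → b t ≡ false × b′ t ≡ true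
  ⊊ᵇ-witness b b′ b⊆b′ b≢b′ with FinP.any? (λ t → (b t Bool.≟ false) ×-dec (b′ t Bool.≟ true))
  ... | yes witness = witness
  ... | no  none    = ⊥-elim (b≢b′ equal)
    where
    equal : ∀ t → b t ≡ b′ t
    equal t with b t in bt
    ... | true  = ≡.sym (b⊆b′ t bt)
    ... | false = ≡.sym (BoolP.¬-not (λ b′t → none (t , bt , b′t)))

  count-⊊ : ∀ n {b b′ : Fin n → Bool} → b ⊆ᵇ b′ → ¬ (∀ t → b t ≡ b′ t) → count n b ℕ.< count n b′
  count-⊊ n {b} {b′} b⊆b′ b≢b′ with ⊊ᵇ-witness b b′ b⊆b′ b≢b′
  ... | t , bt , b′t = count-strict n b⊆b′ t bt b′t

module Sums {c ℓ} (R : CommutativeRing c ℓ) where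
  open CommutativeRing R renaming (Carrier to C)
  open import Algebra.Properties.Semiring.Sum semiring public
    using (sum; sum-cong-≋; sum-replicate-zero; sum-remove; sum-permute; ∑-comm; *-distribˡ-sum; *-distribʳ-sum)

  sumFin≡sum : ∀ {a ℓ₁} (G : AbelianGroup a ℓ₁) m (f : Fin m → C) → sumFin G R m f ≡ sum f
  sumFin≡sum G zero    f = ≡.refl
  sumFin≡sum G (suc m) f = ≡.cong (f fzero +_) (sumFin≡sum G m (f ∘ fsuc))

  sum-zero : ∀ {m} {f : Fin m → C} → (∀ i → f i ≈ 0#) → sum f ≈ 0#
  sum-zero {m} f≈0 = trans (sum-cong-≋ f≈0) (sum-replicate-zero m)

  sum-single : ∀ {m} (f : Fin m → C) (i : Fin m) → (∀ j → ¬ (j ≡ i) → f j ≈ 0#) → sum f ≈ f i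
  sum-single {suc m} f i others≈0 = trans (sum-remove {i = i} f)
    (trans (+-congˡ (sum-zero (λ j → others≈0 _ (FinP.punchInᵢ≢i i j)))) (+-identityʳ _))

  sum-bits : ∀ n (b : Fin n → Bool) → sum (λ t → if b t then 1# else 0#) ≈ natMul R (Counting.count n b)
  sum-bits zero    b = refl
  sum-bits (suc n) b with b fzero
  ... | true  = +-congˡ (sum-bits n (b ∘ fsuc))
  ... | false = trans (+-identityˡ _) (sum-bits n (b ∘ fsuc))

module FirstTrue where
  firstTrue : (ℕ → Bool) → ℕ → ℕ
  firstTrue Q zero    = zero
  firstTrue Q (suc k) = if Q zero then zero else suc (firstTrue (Q ∘ suc) k)

  firstTrue-true : ∀ (Q : ℕ → Bool) k n → n ℕ.≤ k → Q n ≡ true → Q (firstTrue Q k) ≡ true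
  firstTrue-true Q zero    zero    _  Qn = Qn
  firstTrue-true Q (suc k) n       n≤k Qn with Q zero in Q0
  firstTrue-true Q (suc k) n       n≤k Qn | true  = Q0
  firstTrue-true Q (suc k) zero    _   Qn | false = ⊥-elim (true-and-false Qn Q0)
  firstTrue-true Q (suc k) (suc n) n≤k Qn | false =
    firstTrue-true (Q ∘ suc) k n (ℕP.≤-pred n≤k) Qn

  firstTrue-≤ : ∀ (Q : ℕ → Bool) k → firstTrue Q k ℕ.≤ k
  firstTrue-≤ Q zero    = ℕ.z≤n
  firstTrue-≤ Q (suc k) with Q zero
  ... | true  = ℕ.z≤n
  ... | false = ℕ.s≤s (firstTrue-≤ (Q ∘ suc) k)

  firstTrue-least : ∀ (Q : ℕ → Bool) k n → n ℕ.< firstTrue Q k → Q n ≡ false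
  firstTrue-least Q (suc k) n       lt with Q zero in Q0
  firstTrue-least Q (suc k) zero    lt | false = Q0
  firstTrue-least Q (suc k) (suc n) lt | false = firstTrue-least (Q ∘ suc) k n (ℕP.≤-pred lt)

  firstTrue-cong : ∀ {Q Q′ : ℕ → Bool} → (∀ n → Q n ≡ Q′ n) → ∀ k → firstTrue Q k ≡ firstTrue Q′ k
  firstTrue-cong Q≗Q′ zero = ≡.refl
  firstTrue-cong {Q} {Q′} Q≗Q′ (suc k) rewrite Q≗Q′ zero with Q′ zero
  ... | true  = ≡.refl
  ... | false = ≡.cong suc (firstTrue-cong (Q≗Q′ ∘ suc) k)

module GroupFacts {a ℓ} (G : AbelianGroup a ℓ) where
  open AbelianGroup G
  open import Algebra.Properties.Monoid.Mult monoid public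
    using () renaming (_×_ to _·_; ×-homo-+ to ·-homo-+)
  open import Algebra.Properties.Group group using (ε⁻¹≈ε; ⁻¹-involutive)
  open import Algebra.Properties.AbelianGroup G using (⁻¹-∙-comm)
  open import Algebra.Solver.CommutativeMonoid commutativeMonoid using (solve; _⊜_; _⊕_)
  open SetoidReasoning setoid

  ⁻¹-distrib : ∀ x y → (x ∙ y) ⁻¹ ≈ x ⁻¹ ∙ y ⁻¹
  ⁻¹-distrib x y = sym (⁻¹-∙-comm x y)

  cancelˡ : ∀ x w → x ⁻¹ ∙ (x ∙ w) ≈ w
  cancelˡ x w = begin
    x ⁻¹ ∙ (x ∙ w) ≈⟨ sym (assoc _ _ _) ⟩
    (x ⁻¹ ∙ x) ∙ w ≈⟨ ∙-congʳ (inverseˡ x) ⟩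
    ε ∙ w          ≈⟨ identityˡ w ⟩
    w              ∎

  ∙ε⁻¹ : ∀ z → z ∙ ε ⁻¹ ≈ z
  ∙ε⁻¹ z = trans (∙-congˡ ε⁻¹≈ε) (identityʳ z)

  -- The following identities, for c = a ∙ b, govern the "quotients" z ∙ a⁻¹
  -- used to describe cosets of a subgroup.
  quotient-shift : ∀ z a b c → c ≈ a ∙ b → (z ∙ c ⁻¹) ∙ b ≈ z ∙ a ⁻¹
  quotient-shift z a b c c≈ab = begin
    (z ∙ c ⁻¹) ∙ b            ≈⟨ ∙-congʳ (∙-congˡ (trans (⁻¹-cong c≈ab) (⁻¹-distrib a b))) ⟩
    (z ∙ (a ⁻¹ ∙ b ⁻¹)) ∙ b   ≈⟨ solve 4 (λ z a b w → ((z ⊕ (a ⊕ b)) ⊕ w) ⊜ ((z ⊕ a) ⊕ (b ⊕ w)))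
                                   refl z (a ⁻¹) (b ⁻¹) b ⟩
    (z ∙ a ⁻¹) ∙ (b ⁻¹ ∙ b)   ≈⟨ ∙-congˡ (inverseˡ b) ⟩
    (z ∙ a ⁻¹) ∙ ε            ≈⟨ identityʳ _ ⟩
    z ∙ a ⁻¹                  ∎

  quotient-∙ : ∀ z₁ z₂ a b c → c ≈ a ∙ b → (z₁ ∙ z₂) ∙ c ⁻¹ ≈ (z₁ ∙ a ⁻¹) ∙ (z₂ ∙ b ⁻¹)
  quotient-∙ z₁ z₂ a b c c≈ab = begin
    (z₁ ∙ z₂) ∙ c ⁻¹          ≈⟨ ∙-congˡ (trans (⁻¹-cong c≈ab) (⁻¹-distrib a b)) ⟩
    (z₁ ∙ z₂) ∙ (a ⁻¹ ∙ b ⁻¹) ≈⟨ solve 4 (λ z₁ z₂ a b → ((z₁ ⊕ z₂) ⊕ (a ⊕ b)) ⊜ ((z₁ ⊕ a) ⊕ (z₂ ⊕ b)))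
                                   refl z₁ z₂ (a ⁻¹) (b ⁻¹) ⟩
    (z₁ ∙ a ⁻¹) ∙ (z₂ ∙ b ⁻¹) ∎

  quotient-⁻¹ : ∀ z a b c → c ≈ a ∙ b → (z ∙ a ⁻¹) ⁻¹ ∙ c ⁻¹ ≈ z ⁻¹ ∙ b ⁻¹
  quotient-⁻¹ z a b c c≈ab = begin
    (z ∙ a ⁻¹) ⁻¹ ∙ c ⁻¹      ≈⟨ ∙-cong (trans (⁻¹-distrib z (a ⁻¹)) (∙-congˡ (⁻¹-involutive a)))
                                        (trans (⁻¹-cong c≈ab) (⁻¹-distrib a b)) ⟩
    (z ⁻¹ ∙ a) ∙ (a ⁻¹ ∙ b ⁻¹) ≈⟨ solve 4 (λ z a a′ b → ((z ⊕ a) ⊕ (a′ ⊕ b)) ⊜ ((z ⊕ b) ⊕ (a ⊕ a′)))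
                                   refl (z ⁻¹) a (a ⁻¹) (b ⁻¹) ⟩
    (z ⁻¹ ∙ b ⁻¹) ∙ (a ∙ a ⁻¹) ≈⟨ ∙-congˡ (inverseʳ a) ⟩
    (z ⁻¹ ∙ b ⁻¹) ∙ ε          ≈⟨ identityʳ _ ⟩
    z ⁻¹ ∙ b ⁻¹                ∎

  open Subgroup

  ∈-resp-≈ : (H : Subgroup G) → ∀ {x y} → x ≈ y → mem H x ≡ true → mem H y ≡ true
  ∈-resp-≈ H x≈y x∈H = ≡.trans (≡.sym (mem-cong H x≈y)) x∈H

  mem-translate : ∀ K {k} x → mem K k ≡ true → mem K (k ∙ x) ≡ mem K x
  mem-translate K {k} x k∈K with mem K x in x∈K | mem K (k ∙ x) in kx∈K
  ... | true  | _     = ≡.trans (≡.sym kx∈K) (mem-∙ K k∈K x∈K)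
  ... | false | false = ≡.refl
  ... | false | true  = ⊥-elim (true-and-false
      (∈-resp-≈ K (cancelˡ k x) (mem-∙ K (mem-⁻¹ K k∈K) kx∈K)) x∈K)

module Extension {a ℓ c ℓ′} (G : AbelianGroup a ℓ)
    (R : CommutativeRing c ℓ′) (F : IsAlgClosedChar0Field R) where
  private module G = AbelianGroup G
  open G using (_∙_; ε; _⁻¹) renaming (Carrier to A; _≈_ to _≈G_)
  open CommutativeRing R hiding (zero) renaming (Carrier to C)
  open IsAlgClosedChar0Field F using (1≉0)
  open Powers R
  open FieldFacts R F
  open GroupFacts G
  open Subgroup
  open SetoidReasoning setoid
  open import Algebra.Solver.Ring.NaturalCoefficients.Default commutativeSemiring

  -- A character of the subgroup H: a nowhere-vanishing function on G that
  -- is multiplicative on H (its values off H play no role).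
  record PartialCharacter (H : Subgroup G) : Set (a ⊔ ℓ ⊔ c ⊔ ℓ′) where
    field
      fun         : A → C
      fun-cong    : ∀ {x y} → x ≈G y → fun x ≈ fun y
      fun-nonzero : ∀ x → ¬ (fun x ≈ 0#)
      fun-hom     : ∀ x y → mem H x ≡ true → mem H y ≡ true → fun (x ∙ y) ≈ fun x * fun y

    fun-ε : fun ε ≈ 1#
    fun-ε = sym (*-cancelˡ (fun-nonzero ε) (begin
      fun ε * 1#    ≈⟨ *-identityʳ _ ⟩
      fun ε         ≈⟨ fun-cong (G.sym (G.identityˡ ε)) ⟩
      fun (ε ∙ ε)   ≈⟨ fun-hom ε ε (mem-ε H) (mem-ε H) ⟩
      fun ε * fun ε ∎))
  open PartialCharacter

  trivial-character : (H : Subgroup G) → PartialCharacter H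
  trivial-character H = record
    { fun = λ _ → 1# ; fun-cong = λ _ → refl ; fun-nonzero = λ _ → 1≉0
    ; fun-hom = λ _ _ _ _ → sym (*-identityˡ 1#) }

  -- Let d = d′+1 be the least exponent with yᵈ ∈ H and
  -- let c₀ᵈ = φ(yᵈ).  Then H⁺ = H ∪ yH ∪ … ∪ yᵈ⁻¹H is a subgroup, and
  -- φ⁺(z) = φ(z y⁻ⁿ) c₀ⁿ for z ∈ yⁿH is a character of H⁺ extending φ
  -- with φ⁺(y) = c₀.
  module Step (H : Subgroup G) (φ : PartialCharacter H) (y : A) (d′ : ℕ)
      (y^d∈H : mem H (suc d′ · y) ≡ true)
      (d-least : ∀ e → e ℕ.< d′ → mem H (suc e · y) ≡ false)
      (c₀ : C) (c₀^d : c₀ ^ suc d′ ≈ fun φ (suc d′ · y)) where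
    open FirstTrue

    d : ℕ
    d = suc d′

    inCoset : A → ℕ → Bool
    inCoset z n = mem H (z ∙ (n · y) ⁻¹)

    -- on the powers of y lying in H, φ agrees with n ↦ c₀ⁿ (induction on a bound B for e)
    φ-on-powers : ∀ B e → e ℕ.≤ B → mem H (e · y) ≡ true → fun φ (e · y) ≈ c₀ ^ e
    φ-on-powers B       zero    _    _      = fun-ε φ
    φ-on-powers (suc B) (suc e) e≤B y^e∈H with e ℕP.<? d′
    ... | yes e<d′ = ⊥-elim (true-and-false y^e∈H (d-least e e<d′))
    ... | no  e≮d′ with ℕP.m≤n⇒∃[o]m+o≡n (ℕP.≮⇒≥ e≮d′)
    ...   | r , ≡.refl = begin
      fun φ ((d ℕ.+ r) · y)             ≈⟨ fun-cong φ (·-homo-+ y d r) ⟩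
      fun φ (d · y ∙ r · y)             ≈⟨ fun-hom φ _ _ y^d∈H y^r∈H ⟩
      fun φ (d · y) * fun φ (r · y)     ≈⟨ *-cong (sym c₀^d)
                                             (φ-on-powers B r (ℕP.≤-trans (ℕP.m≤n+m r d′) (ℕP.≤-pred e≤B)) y^r∈H) ⟩
      c₀ ^ d * c₀ ^ r                   ≈⟨ sym (^-homo-* c₀ d r) ⟩
      c₀ ^ (d ℕ.+ r)                    ∎
      where
      y^r∈H : mem H (r · y) ≡ true
      y^r∈H = ∈-resp-≈ H (G.trans (G.∙-congˡ (·-homo-+ y d r)) (cancelˡ _ _))
                (mem-∙ H (mem-⁻¹ H y^d∈H) y^e∈H)

    φ⁺-well-defined≤ : ∀ z s e → inCoset z s ≡ true → inCoset z (s ℕ.+ e) ≡ true →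
      fun φ (z ∙ (s · y) ⁻¹) * c₀ ^ s ≈ fun φ (z ∙ ((s ℕ.+ e) · y) ⁻¹) * c₀ ^ (s ℕ.+ e)
    φ⁺-well-defined≤ z s e z∈yˢH z∈yˢ⁺ᵉH = begin
      fun φ u * c₀ ^ s                 ≈⟨ *-congʳ (fun-cong φ (G.sym v∙yᵉ≈u)) ⟩
      fun φ (v ∙ e · y) * c₀ ^ s       ≈⟨ *-congʳ (fun-hom φ _ _ z∈yˢ⁺ᵉH y^e∈H) ⟩
      (fun φ v * fun φ (e · y)) * c₀ ^ s ≈⟨ *-congʳ (*-congˡ (φ-on-powers e e ℕP.≤-refl y^e∈H)) ⟩
      (fun φ v * c₀ ^ e) * c₀ ^ s      ≈⟨ solve 3 (λ p q r → (p :* q) :* r := p :* (r :* q)) refl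
                                            (fun φ v) (c₀ ^ e) (c₀ ^ s) ⟩
      fun φ v * (c₀ ^ s * c₀ ^ e)      ≈⟨ *-congˡ (sym (^-homo-* c₀ s e)) ⟩
      fun φ v * c₀ ^ (s ℕ.+ e)         ∎
      where
      u = z ∙ (s · y) ⁻¹
      v = z ∙ ((s ℕ.+ e) · y) ⁻¹
      v∙yᵉ≈u : v ∙ e · y ≈G u
      v∙yᵉ≈u = quotient-shift z (s · y) (e · y) _ (·-homo-+ y s e)
      y^e∈H : mem H (e · y) ≡ true
      y^e∈H = ∈-resp-≈ H (G.trans (G.∙-congˡ (G.sym v∙yᵉ≈u)) (cancelˡ v _))
                (mem-∙ H (mem-⁻¹ H z∈yˢ⁺ᵉH) z∈yˢH)

    φ⁺-well-defined : ∀ z s t → inCoset z s ≡ true → inCoset z t ≡ true →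
      fun φ (z ∙ (s · y) ⁻¹) * c₀ ^ s ≈ fun φ (z ∙ (t · y) ⁻¹) * c₀ ^ t
    φ⁺-well-defined z s t zs zt with ℕP.≤-total s t
    ... | inj₁ s≤t with ℕP.m≤n⇒∃[o]m+o≡n s≤t
    ...   | r , ≡.refl = φ⁺-well-defined≤ z s r zs zt
    φ⁺-well-defined z s t zs zt | inj₂ t≤s with ℕP.m≤n⇒∃[o]m+o≡n t≤s
    ...   | r , ≡.refl = sym (φ⁺-well-defined≤ z t r zt zs)

    index : A → ℕ
    index z = firstTrue (inCoset z) d

    mem⁺ : A → Bool
    mem⁺ z = inCoset z (index z)

    φ⁺ : A → C
    φ⁺ z = fun φ (z ∙ (index z · y) ⁻¹) * c₀ ^ index z

    mem⁺-intro : ∀ z n → n ℕ.≤ d → inCoset z n ≡ true → mem⁺ z ≡ true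
    mem⁺-intro z n n≤d zn = firstTrue-true (inCoset z) d n n≤d zn

    φ⁺-at : ∀ z s → inCoset z s ≡ true → mem⁺ z ≡ true → φ⁺ z ≈ fun φ (z ∙ (s · y) ⁻¹) * c₀ ^ s
    φ⁺-at z s zs z∈H⁺ = φ⁺-well-defined z (index z) s z∈H⁺ zs

    inCoset-cong : ∀ {z z′} → z ≈G z′ → ∀ n → inCoset z n ≡ inCoset z′ n
    inCoset-cong z≈z′ n = mem-cong H (G.∙-congʳ z≈z′)

    index-cong : ∀ {z z′} → z ≈G z′ → index z ≡ index z′
    index-cong z≈z′ = firstTrue-cong (inCoset-cong z≈z′) d

    -- yᵈ ∈ H, so coset indices may be reduced by d
    inCoset-reduce : ∀ z r → inCoset z (d ℕ.+ r) ≡ true → inCoset z r ≡ true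
    inCoset-reduce z r z∈yᵈ⁺ʳH = ∈-resp-≈ H
      (quotient-shift z (r · y) (d · y) _ (G.trans (·-homo-+ y d r) (G.comm _ _)))
      (mem-∙ H z∈yᵈ⁺ʳH y^d∈H)

    inCoset-∙ : ∀ z₁ z₂ n₁ n₂ → inCoset z₁ n₁ ≡ true → inCoset z₂ n₂ ≡ true →
      inCoset (z₁ ∙ z₂) (n₁ ℕ.+ n₂) ≡ true
    inCoset-∙ z₁ z₂ n₁ n₂ z₁∈ z₂∈ = ∈-resp-≈ H
      (G.sym (quotient-∙ z₁ z₂ (n₁ · y) (n₂ · y) _ (·-homo-+ y n₁ n₂))) (mem-∙ H z₁∈ z₂∈)

    mem⁺-∙ : ∀ {z₁ z₂} → mem⁺ z₁ ≡ true → mem⁺ z₂ ≡ true → mem⁺ (z₁ ∙ z₂) ≡ true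
    mem⁺-∙ {z₁} {z₂} z₁∈ z₂∈ with (index z₁ ℕ.+ index z₂) ℕP.≤? d
    ... | yes sum≤d = mem⁺-intro (z₁ ∙ z₂) (index z₁ ℕ.+ index z₂) sum≤d (inCoset-∙ z₁ z₂ (index z₁) (index z₂) z₁∈ z₂∈)
    ... | no  sum≰d with ℕP.m≤n⇒∃[o]m+o≡n (ℕP.<⇒≤ (ℕP.≰⇒> sum≰d))
    ...   | r , d+r≡sum = mem⁺-intro (z₁ ∙ z₂) r r≤d (inCoset-reduce (z₁ ∙ z₂) r
              (≡.subst (λ k → inCoset (z₁ ∙ z₂) k ≡ true) (≡.sym d+r≡sum) (inCoset-∙ z₁ z₂ (index z₁) (index z₂) z₁∈ z₂∈)))
      where
      r≤d : r ℕ.≤ d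
      r≤d = ℕP.+-cancelˡ-≤ d r d (≡.subst (ℕ._≤ d ℕ.+ d) (≡.sym d+r≡sum)
        (ℕP.+-mono-≤ (firstTrue-≤ (inCoset z₁) d) (firstTrue-≤ (inCoset z₂) d)))

    mem⁺-⁻¹ : ∀ {z} → mem⁺ z ≡ true → mem⁺ (z ⁻¹) ≡ true
    mem⁺-⁻¹ {z} z∈ with ℕP.m≤n⇒∃[o]m+o≡n (firstTrue-≤ (inCoset z) d)
    ... | k , index+k≡d = mem⁺-intro (z ⁻¹) k k≤d
      (∈-resp-≈ H (quotient-⁻¹ z (index z · y) (k · y) (d · y) yᵈ≈)
        (mem-∙ H (mem-⁻¹ H z∈) (mem-⁻¹ H y^d∈H)))
      where
      yᵈ≈ : d · y ≈G index z · y ∙ k · y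
      yᵈ≈ = G.trans (G.reflexive (≡.cong (_· y) (≡.sym index+k≡d))) (·-homo-+ y (index z) k)
      k≤d : k ℕ.≤ d
      k≤d = ≡.subst (k ℕ.≤_) index+k≡d (ℕP.m≤n+m k (index z))

    H⁺ : Subgroup G
    H⁺ = record
      { mem      = mem⁺
      ; mem-cong = λ {z} {z′} z≈z′ → ≡.trans (≡.cong (inCoset z) (index-cong z≈z′)) (inCoset-cong z≈z′ (index z′))
      ; mem-ε    = mem⁺-intro ε 0 ℕ.z≤n (∈-resp-≈ H (G.sym (G.inverseʳ ε)) (mem-ε H))
      ; mem-∙    = mem⁺-∙
      ; mem-⁻¹   = mem⁺-⁻¹
      }

    φ⁺-hom : ∀ z₁ z₂ → mem⁺ z₁ ≡ true → mem⁺ z₂ ≡ true → φ⁺ (z₁ ∙ z₂) ≈ φ⁺ z₁ * φ⁺ z₂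
    φ⁺-hom z₁ z₂ z₁∈ z₂∈ = begin
      φ⁺ (z₁ ∙ z₂)  ≈⟨ φ⁺-at (z₁ ∙ z₂) (n₁ ℕ.+ n₂) (inCoset-∙ z₁ z₂ n₁ n₂ z₁∈ z₂∈) (mem⁺-∙ z₁∈ z₂∈) ⟩
      fun φ ((z₁ ∙ z₂) ∙ ((n₁ ℕ.+ n₂) · y) ⁻¹) * c₀ ^ (n₁ ℕ.+ n₂)
                    ≈⟨ *-cong (fun-cong φ (quotient-∙ z₁ z₂ (n₁ · y) (n₂ · y) _ (·-homo-+ y n₁ n₂)))
                              (^-homo-* c₀ n₁ n₂) ⟩
      fun φ (u₁ ∙ u₂) * (c₀ ^ n₁ * c₀ ^ n₂)
                    ≈⟨ *-congʳ (fun-hom φ _ _ z₁∈ z₂∈) ⟩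
      (fun φ u₁ * fun φ u₂) * (c₀ ^ n₁ * c₀ ^ n₂)
                    ≈⟨ solve 4 (λ a b p q → (a :* b) :* (p :* q) := (a :* p) :* (b :* q)) refl
                         (fun φ u₁) (fun φ u₂) (c₀ ^ n₁) (c₀ ^ n₂) ⟩
      φ⁺ z₁ * φ⁺ z₂ ∎
      where
      n₁ = index z₁
      n₂ = index z₂
      u₁ = z₁ ∙ (n₁ · y) ⁻¹
      u₂ = z₂ ∙ (n₂ · y) ⁻¹

    c₀≉0 : ¬ (c₀ ≈ 0#)
    c₀≉0 c₀≈0 = fun-nonzero φ _ (trans (sym c₀^d) (trans (*-congʳ c₀≈0) (zeroˡ _)))

    φ⁺-character : PartialCharacter H⁺
    φ⁺-character = record
      { fun         = φ⁺
      ; fun-cong    = λ {z} {z′} z≈z′ → ≡.subst (λ k → φ⁺ z ≈ fun φ (z′ ∙ (k · y) ⁻¹) * c₀ ^ k)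
                        (index-cong z≈z′) (*-congʳ (fun-cong φ (G.∙-congʳ z≈z′)))
      ; fun-nonzero = λ z → *-nonzero (fun-nonzero φ _) (^-nonzero (index z) c₀≉0)
      ; fun-hom     = φ⁺-hom
      }

    H⊆H⁺ : ∀ z → mem H z ≡ true → mem⁺ z ≡ true
    H⊆H⁺ z z∈H = mem⁺-intro z 0 ℕ.z≤n (∈-resp-≈ H (G.sym (∙ε⁻¹ z)) z∈H)

    φ⁺-extends : ∀ z → mem H z ≡ true → φ⁺ z ≈ fun φ z
    φ⁺-extends z z∈H = trans (φ⁺-at z 0 (∈-resp-≈ H (G.sym (∙ε⁻¹ z)) z∈H) (H⊆H⁺ z z∈H))
      (trans (*-identityʳ _) (fun-cong φ (∙ε⁻¹ z)))

    y∙y⁻¹≈ε : y ∙ (1 · y) ⁻¹ ≈G ε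
    y∙y⁻¹≈ε = G.trans (G.∙-congˡ (G.⁻¹-cong (G.identityʳ y))) (G.inverseʳ y)

    y∈yH : inCoset y 1 ≡ true
    y∈yH = ∈-resp-≈ H (G.sym y∙y⁻¹≈ε) (mem-ε H)

    y∈H⁺ : mem⁺ y ≡ true
    y∈H⁺ = mem⁺-intro y 1 (ℕ.s≤s ℕ.z≤n) y∈yH

    φ⁺-y : φ⁺ y ≈ c₀
    φ⁺-y = begin
      φ⁺ y                              ≈⟨ φ⁺-at y 1 y∈yH y∈H⁺ ⟩
      fun φ (y ∙ (1 · y) ⁻¹) * (c₀ * 1#) ≈⟨ *-cong (trans (fun-cong φ y∙y⁻¹≈ε) (fun-ε φ)) (*-identityʳ c₀) ⟩
      1# * c₀                           ≈⟨ *-identityˡ c₀ ⟩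
      c₀                                ∎

module Separation {a ℓ c ℓ′} (G : AbelianGroup a ℓ) (fin : IsFinite G)
    (R : CommutativeRing c ℓ′) (F : IsAlgClosedChar0Field R) where
  module G = AbelianGroup G
  open G using (_∙_; ε; _⁻¹) renaming (Carrier to A; _≈_ to _≈G_)
  open CommutativeRing R hiding (zero) renaming (Carrier to C)
  open IsFinite fin
  open Powers R
  open FieldFacts R F
  open GroupFacts G
  open Extension G R F
  open PartialCharacter
  open Subgroup
  open FirstTrue

  -- every element has finite order: two of ε, y, …, y^size coincide (pigeonhole)
  finite-order : (y : A) → ∃ λ N → suc N · y ≈G ε
  finite-order y with FinP.pigeonhole (ℕP.n<1+n size) (λ i → toFin (toℕ i · y))
  ... | i , j , i<j , same with ℕP.m≤n⇒∃[o]m+o≡n i<j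
  ...   | r , i+1+r≡j = r , G.trans (G.sym (cancelˡ yⁱ yʳ⁺¹))
          (G.trans (G.∙-congˡ (G.sym (G.trans yⁱ≈yʲ yʲ≈yⁱyʳ⁺¹))) (G.inverseˡ yⁱ))
    where
    yⁱ = toℕ i · y
    yʳ⁺¹ = suc r · y
    yⁱ≈yʲ : yⁱ ≈G toℕ j · y
    yⁱ≈yʲ = G.trans (G.sym (fromFin-toFin _)) (G.trans (G.reflexive (≡.cong fromFin same)) (fromFin-toFin _))
    yʲ≈yⁱyʳ⁺¹ : toℕ j · y ≈G yⁱ ∙ yʳ⁺¹
    yʲ≈yⁱyʳ⁺¹ = G.trans (G.reflexive (≡.cong (_· y) (≡.trans (≡.sym i+1+r≡j) (≡.sym (ℕP.+-suc (toℕ i) r)))))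
                  (·-homo-+ y (toℕ i) (suc r))

  least-power-in : (H : Subgroup G) (y : A) → Σ ℕ λ d′ → (mem H (suc d′ · y) ≡ true) ×
    (∀ e → e ℕ.< d′ → mem H (suc e · y) ≡ false)
  least-power-in H y with finite-order y
  ... | N , yᴺ⁺¹≈ε = firstTrue Q N
                   , firstTrue-true Q N N ℕP.≤-refl (∈-resp-≈ H (G.sym yᴺ⁺¹≈ε) (mem-ε H))
                   , firstTrue-least Q N
    where
    Q : ℕ → Bool
    Q e = mem H (suc e · y)

  record ExtensionOf (H : Subgroup G) (φ : PartialCharacter H) : Set (a ⊔ ℓ ⊔ c ⊔ ℓ′) where
    field
      H*      : Subgroup G
      φ*      : PartialCharacter H*
      H⊆H*    : ∀ z → mem H z ≡ true → mem H* z ≡ true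
      extends : ∀ z → mem H z ≡ true → fun φ* z ≈ fun φ z
  open ExtensionOf

  trivial-extension : ∀ {H} (φ : PartialCharacter H) → ExtensionOf H φ
  trivial-extension {H} φ = record { H* = H ; φ* = φ ; H⊆H* = λ _ z∈H → z∈H ; extends = λ _ _ → refl }

  compose : ∀ {H φ} (E : ExtensionOf H φ) → ExtensionOf (H* E) (φ* E) → ExtensionOf H φ
  compose E E′ = record
    { H* = H* E′ ; φ* = φ* E′
    ; H⊆H* = λ z z∈H → H⊆H* E′ z (H⊆H* E z z∈H)
    ; extends = λ z z∈H → trans (extends E′ z (H⊆H* E z z∈H)) (extends E z z∈H) }

  -- one step: extend so that a given y is covered (a d-th root c₀ of φ(yᵈ) exists)
  extend-to : ∀ {H} (φ : PartialCharacter H) (y : A) → Σ (ExtensionOf H φ) λ E → mem (H* E) y ≡ true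
  extend-to {H} φ y with mem H y in y∈H
  ... | true  = trivial-extension φ , y∈H
  ... | false with least-power-in H y
  ...   | d′ , y^d∈H , d-least with root (fun φ (suc d′ · y)) d′
  ...     | c₀ , c₀^d = record { H* = H⁺ ; φ* = φ⁺-character ; H⊆H* = H⊆H⁺ ; extends = φ⁺-extends } , y∈H⁺
    where open Step H φ y d′ y^d∈H d-least c₀ c₀^d

  extend-to-all : ∀ {H} (φ : PartialCharacter H) n (g : Fin n → A) →
    Σ (ExtensionOf H φ) λ E → ∀ i → mem (H* E) (g i) ≡ true
  extend-to-all φ zero    g = trivial-extension φ , λ ()
  extend-to-all φ (suc n) g with extend-to φ (g fzero)
  ... | E₀ , g₀∈ with extend-to-all (φ* E₀) n (g ∘ fsuc)
  ...   | E₁ , rest∈ = compose E₀ E₁ , covered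
    where
    covered : ∀ i → mem (H* E₁) (g i) ≡ true
    covered fzero    = H⊆H* E₁ _ g₀∈
    covered (fsuc i) = rest∈ i

  extend-to-G : ∀ {H} (φ : PartialCharacter H) →
    Σ (Character G R) λ ψ → ∀ z → mem H z ≡ true → χ ψ z ≈ fun φ z
  extend-to-G φ with extend-to-all φ size fromFin
  ... | E , all∈ = ψ , extends E
    where
    everything∈ : ∀ z → mem (H* E) z ≡ true
    everything∈ z = ∈-resp-≈ (H* E) (fromFin-toFin z) (all∈ (toFin z))
    ψ : Character G R
    ψ = record { χ = fun (φ* E) ; χ-cong = fun-cong (φ* E) ; χ-unit = fun-nonzero (φ* E)
               ; χ-hom = λ u v → fun-hom (φ* E) u v (everything∈ u) (everything∈ v) }

  -- Separation: for x ∉ K, let d ≥ 2 be the order of x modulo K; extend the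
  -- trivial character of K to ⟨K, x⟩ by x ↦ ζ, a d-th root of unity ζ ≠ 1,
  -- and then to all of G.
  separate : (K : Subgroup G) (x : A) → mem K x ≡ false →
    Σ (Character G R) λ ψ → (_∈⊥_ G R ψ K) × ¬ (χ ψ x ≈ 1#)
  separate K x x∉K with least-power-in K x
  ... | zero , x¹∈K , _ = ⊥-elim (true-and-false (∈-resp-≈ K (G.identityʳ x) x¹∈K) x∉K)
  ... | suc k , x^d∈K , d-least with nontrivial-root-of-unity k
  ...   | ζ , ζ^d≈1 , ζ≉1 = ψ , ψ∈K⊥ , ψx≉1
    where
    open Step K (trivial-character K) x (suc k) x^d∈K d-least ζ ζ^d≈1
    ψ : Character G R
    ψ = proj₁ (extend-to-G φ⁺-character)
    ψ-extends : ∀ z → mem⁺ z ≡ true → χ ψ z ≈ φ⁺ z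
    ψ-extends = proj₂ (extend-to-G φ⁺-character)
    ψ∈K⊥ : _∈⊥_ G R ψ K
    ψ∈K⊥ z z∈K = trans (ψ-extends z (H⊆H⁺ z z∈K)) (φ⁺-extends z z∈K)
    ψx≉1 : ¬ (χ ψ x ≈ 1#)
    ψx≉1 ψx≈1 = ζ≉1 (trans (sym φ⁺-y) (trans (sym (ψ-extends x y∈H⁺)) ψx≈1))

  -- If K^⊥ is generated by ψ then ker ψ ⊆ K: a point x ∉ K is detected by
  -- some φ ∈ K^⊥, and φ is a power of ψ, so ψ(x) ≠ 1.
  generator-kernel : ∀ K → (ψ-gen : PerpCyclic G R K) → ∀ x → χ (proj₁ ψ-gen) x ≈ 1# → mem K x ≡ true
  generator-kernel K (ψ , _ , generates) x ψx≈1 with mem K x in x∈K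
  ... | true  = ≡.refl
  ... | false with separate K x x∈K
  ...   | φ , φ∈K⊥ , φx≉1 with generates φ φ∈K⊥
  ...     | n , φ≈ψⁿ = ⊥-elim (φx≉1 (begin
    χ φ x          ≈⟨ φ≈ψⁿ x ⟩
    pow G R (χ ψ x) n ≡⟨ pow≡^ G (χ ψ x) n ⟩
    χ ψ x ^ n      ≈⟨ ^-congˡ n ψx≈1 ⟩
    1# ^ n         ≈⟨ 1^n≈1 n ⟩
    1#             ∎))
    where open SetoidReasoning setoid

module CharacterSums {a ℓ c ℓ′} (G : AbelianGroup a ℓ) (fin : IsFinite G)
    (R : CommutativeRing c ℓ′) (F : IsAlgClosedChar0Field R) where
  private module G = AbelianGroup G
  open G using (_∙_; ε; _⁻¹) renaming (Carrier to A; _≈_ to _≈G_)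
  open CommutativeRing R renaming (Carrier to C)
  open IsFinite fin
  open FieldFacts R F
  open GroupFacts G
  open Sums R
  open Counting
  open Subgroup
  open import Algebra.Solver.Ring.NaturalCoefficients.Default commutativeSemiring
  open SetoidReasoning setoid

  ∑G : (A → C) → C
  ∑G g = sum (λ t → g (fromFin t))

  -- translation invariance: x ↦ w ∙ x permutes G
  ∑G-translate : (g : A → C) → (∀ {x y} → x ≈G y → g x ≈ g y) → ∀ w → ∑G (λ x → g (w ∙ x)) ≈ ∑G g
  ∑G-translate g g-cong w = sym (trans (sum-permute (λ t → g (fromFin t)) π)
      (sum-cong-≋ (λ t → g-cong (fromFin-toFin (w ∙ fromFin t)))))
    where
    to from : Fin size → Fin size
    to   t = toFin (w ∙ fromFin t)
    from t = toFin (w ⁻¹ ∙ fromFin t)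
    to∘from : ∀ t → to (from t) ≡ t
    to∘from t = ≡.trans (toFin-cong (G.trans (G.∙-congˡ (fromFin-toFin _))
      (G.trans (G.sym (G.assoc _ _ _)) (G.trans (G.∙-congʳ (G.inverseʳ w)) (G.identityˡ _)))))
      (toFin-fromFin t)
    from∘to : ∀ t → from (to t) ≡ t
    from∘to t = ≡.trans (toFin-cong (G.trans (G.∙-congˡ (fromFin-toFin _)) (cancelˡ w _))) (toFin-fromFin t)
    π : Perm.Permutation size size
    π = Perm.permutation to from to∘from from∘to

  members : Subgroup G → Fin size → Bool
  members K t = mem K (fromFin t)

  order : Subgroup G → ℕ
  order K = count size (members K)

  order-pos : ∀ K → 1 ℕ.≤ order K
  order-pos K = count-pos size (members K) (toFin ε)
    (≡.trans (mem-cong K (fromFin-toFin ε)) (mem-ε K))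

  same-members⇒same-indicator : ∀ K L → (∀ t → members K t ≡ members L t) →
    ∀ x → indicator G R K x ≈ indicator G R L x
  same-members⇒same-indicator K L same x = reflexive
    (≡.cong (λ b → if b then 1# else 0#)
      (≡.trans (mem-cong K (G.sym (fromFin-toFin x)))
        (≡.trans (same (toFin x)) (mem-cong L (fromFin-toFin x)))))

  pairing : Subgroup G → Character G R → C
  pairing K ψ = ∑G (λ x → indicator G R K x * χ ψ x)

  pairing-⊥ : ∀ K ψ → _∈⊥_ G R ψ K → pairing K ψ ≈ natMul R (order K)
  pairing-⊥ K ψ ψ∈K⊥ = trans (sum-cong-≋ (λ t → term (fromFin t))) (sum-bits size (members K))
    where
    term : ∀ x → indicator G R K x * χ ψ x ≈ indicator G R K x
    term x with mem K x in x∈K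
    ... | true  = trans (*-identityˡ _) (ψ∈K⊥ x x∈K)
    ... | false = zeroˡ _

  -- if ψ(k) ≠ 1 for some k ∈ K, the pairing is fixed by multiplication with ψ(k), hence 0
  pairing-not-⊥ : ∀ K ψ {k} → mem K k ≡ true → ¬ (χ ψ k ≈ 1#) → pairing K ψ ≈ 0#
  pairing-not-⊥ K ψ {k} k∈K ψk≉1 = fixed⇒zero ψk≉1 (begin
    χ ψ k * ∑G g                ≈⟨ *-distribˡ-sum (χ ψ k) (λ t → g (fromFin t)) ⟩
    ∑G (λ x → χ ψ k * g x)      ≈⟨ sum-cong-≋ (λ t → sym (translate (fromFin t))) ⟩
    ∑G (λ x → g (k ∙ x))        ≈⟨ ∑G-translate g g-cong k ⟩
    ∑G g                        ∎)
    where
    g : A → C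
    g x = indicator G R K x * χ ψ x
    g-cong : ∀ {x y} → x ≈G y → g x ≈ g y
    g-cong x≈y = *-cong (reflexive (≡.cong (λ b → if b then 1# else 0#) (mem-cong K x≈y))) (χ-cong ψ x≈y)
    translate : ∀ x → g (k ∙ x) ≈ χ ψ k * g x
    translate x = begin
      indicator G R K (k ∙ x) * χ ψ (k ∙ x)
        ≈⟨ *-cong (reflexive (≡.cong (λ b → if b then 1# else 0#) (mem-translate K x k∈K))) (χ-hom ψ k x) ⟩
      indicator G R K x * (χ ψ k * χ ψ x)
        ≈⟨ solve 3 (λ a b c → a :* (b :* c) := b :* (a :* c)) refl (indicator G R K x) (χ ψ k) (χ ψ x) ⟩
      χ ψ k * g x ∎

module Independence {a ℓ c ℓ′} (G : AbelianGroup a ℓ) (fin : IsFinite G)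
    (R : CommutativeRing c ℓ′) (F : IsAlgClosedChar0Field R) where
  open AbelianGroup G using () renaming (Carrier to A)
  open CommutativeRing R renaming (Carrier to C)
  open IsFinite fin
  open FieldFacts R F
  open Sums R
  open Counting
  open Separation G fin R F using (generator-kernel)
  open CharacterSums G fin R F
  open SetoidReasoning setoid

  module _ (m : ℕ) (K : Fin m → Subgroup G) (coef : Fin m → C)
      (relation : ∀ x → sum (λ i → coef i * indicator G R (K i) x) ≈ 0#) where

    paired-relation : ∀ ψ → sum (λ j → coef j * pairing (K j) ψ) ≈ 0#
    paired-relation ψ = begin
      sum (λ j → coef j * ∑G (λ x → 𝟙 j x * χ ψ x))
        ≈⟨ sum-cong-≋ (λ j → *-distribˡ-sum (coef j) (λ t → 𝟙 j (fromFin t) * χ ψ (fromFin t))) ⟩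
      sum (λ j → ∑G (λ x → coef j * (𝟙 j x * χ ψ x)))
        ≈⟨ ∑-comm (λ j t → coef j * (𝟙 j (fromFin t) * χ ψ (fromFin t))) ⟩
      ∑G (λ x → sum (λ j → coef j * (𝟙 j x * χ ψ x)))
        ≈⟨ sum-cong-≋ (λ t → sym (trans (*-distribʳ-sum (χ ψ (fromFin t)) (λ j → coef j * 𝟙 j (fromFin t)))
                                        (sum-cong-≋ (λ j → *-assoc (coef j) (𝟙 j (fromFin t)) (χ ψ (fromFin t)))))) ⟩
      ∑G (λ x → sum (λ j → coef j * 𝟙 j x) * χ ψ x)
        ≈⟨ sum-zero (λ t → trans (*-congʳ (relation (fromFin t))) (zeroˡ _)) ⟩
      0# ∎
      where
      𝟙 : Fin m → A → C
      𝟙 j = indicator G R (K j)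

    module _ (cyclic : ∀ i → PerpCyclic G R (K i))
        (distinct : ∀ i j → ¬ (i ≡ j) → ¬ (∀ x → indicator G R (K i) x ≈ indicator G R (K j) x)) where

      -- Inductive step: if the coefficients of all subgroups smaller than K i
      -- vanish, pair with the generator ψ of (K i)^⊥.  Then ⟨1_{K j}, ψ⟩ = 0 unless
      -- K j ⊆ K i, and for K j ⊊ K i the coefficient vanishes; what remains is
      -- coef i · |K i| = 0.
      coef-vanishes-step : ∀ i → (∀ {j} → order (K j) ℕ.< order (K i) → coef j ≈ 0#) → coef i ≈ 0#
      coef-vanishes-step i smaller-vanish = cancel-nonzero (natMul-nonzero _ (order-pos (K i))) (begin
        natMul R (order (K i)) * coef i      ≈⟨ *-comm _ _ ⟩
        coef i * natMul R (order (K i))      ≈⟨ *-congˡ (sym (pairing-⊥ (K i) ψ ψ∈Kᵢ⊥)) ⟩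
        coef i * pairing (K i) ψ             ≈⟨ sym (sum-single (λ j → coef j * pairing (K j) ψ) i other-terms) ⟩
        sum (λ j → coef j * pairing (K j) ψ) ≈⟨ paired-relation ψ ⟩
        0#                                   ∎)
        where
        ψ = proj₁ (cyclic i)
        ψ∈Kᵢ⊥ = proj₁ (proj₂ (cyclic i))
        other-terms : ∀ j → ¬ (j ≡ i) → coef j * pairing (K j) ψ ≈ 0#
        other-terms j j≢i with ⊆ᵇ-or-witness (members (K j)) (members (K i))
        ... | inj₁ Kⱼ⊆Kᵢ = trans (*-congʳ (smaller-vanish (count-⊊ size Kⱼ⊆Kᵢ
                (λ same → distinct j i j≢i (same-members⇒same-indicator (K j) (K i) same))))) (zeroˡ _)
        ... | inj₂ (t , t∈Kⱼ , t∉Kᵢ) = trans (*-congˡ (pairing-not-⊥ (K j) ψ t∈Kⱼ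
                (λ ψt≈1 → true-and-false (generator-kernel (K i) (cyclic i) (fromFin t) ψt≈1) t∉Kᵢ)))
                (zeroʳ _)

      coef-vanishes : ∀ i → coef i ≈ 0#
      coef-vanishes = All.wfRec (On.wellFounded (λ i → order (K i)) ℕI.<-wellFounded) _
        (λ i → coef i ≈ 0#) coef-vanishes-step

lemma3p7 : ∀ {a ℓ c ℓ'} (G : AbelianGroup a ℓ) → IsFinite G →
    (R : CommutativeRing c ℓ') → IsAlgClosedChar0Field R →
    (m : ℕ) (K : Fin m → Subgroup G) →
    (∀ i → PerpCyclic G R (K i)) →
    (∀ i j → ¬ (i ≡ j) →
      ¬ (∀ x → CommutativeRing._≈_ R (indicator G R (K i) x) (indicator G R (K j) x))) →
    (coef : Fin m → CommutativeRing.Carrier R) →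
    (∀ x → CommutativeRing._≈_ R
      (sumFin G R m (λ i → CommutativeRing._*_ R (coef i) (indicator G R (K i) x)))
      (CommutativeRing.0# R)) →
    ∀ i → CommutativeRing._≈_ R (coef i) (CommutativeRing.0# R)
lemma3p7 G fin R F m K cyclic distinct coef relation =
  Independence.coef-vanishes G fin R F m K coef relation′ cyclic distinct
  where
  open CommutativeRing R
  relation′ : ∀ x → Sums.sum R (λ i → coef i * indicator G R (K i) x) ≈ 0#
  relation′ x = trans (reflexive (≡.sym (Sums.sumFin≡sum R G m _))) (relation x)
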